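{- If $\mathscr{D}$ is a lattice closed under inverse length increasing morphisms and containing $\mathsf{SU}$ (i.e. $\mathsf{SU}(A)\subseteq\mathscr{D}(A)$ for every alphabet $A$), then $\mathsf{MOD}(A)\subseteq[\mathscr{D}](A)$ for every alphabet $A$.
   Context: A class $\mathscr{D}$ assigns to each alphabet $A$ a set $\mathscr{D}(A)$ of regular languages over $A$; it is a lattice if each $\mathscr{D}(A)$ contains $\emptyset,A^*$ and is closed under finite unions and intersections; it is closed under inverse length increasing morphisms if $\alpha^{ -1}(L)\in\mathscr{D}(A)$ whenever $L\in\mathscr{D}(B)$ and $\alpha:A^*\to B^*$ is a monoid morphism with $\alpha(a)\neq\varepsilon$ for all $a$. $\mathsf{SU}(A)$: finite Boolean combinations of $A^*w$, $w\in A^*$. $\mathsf{MOD}(A)$: finite Boolean combinations of $\{w\mid |w|\equiv m\bmod d\}$ ($m<d$). Block abstraction: for $d\ge1$, $A_d$ is the alphabet whose letters are the nonempty words over $A$ of length at most $d$; $\mu_d:A^*\to A_d^*$ cuts $w$ into consecutive factors of length $d$ from the left, the last factor being of length $<d$ and omitted if empty, and returns the sequence of factors as letters. $[\mathscr{D}]_d(A)=\{\mu_d^{ -1}(K)\mid K\in\mathscr{D}(A_d)\}$ and $[\mathscr{D}](A)=\bigcup_{d\ge1}[\mathscr{D}]_d(A)$. -}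

module Defs where

open import Data.Bool using (Bool; true; false; _∧_; _∨_; not)
open import Data.Nat using (ℕ; zero; suc; _≤_; _<_; z≤n; s≤s; _≟_)
open import Data.Nat.Properties using (≤∧≢⇒<; m≤n⇒m≤1+n)
open import Data.Nat.DivMod using (_%_)
open import Data.Fin using (Fin; toℕ; fromℕ<)
open import Data.Fin.Properties using (toℕ-fromℕ<)
open import Data.List using (List; []; _∷_; length; map; concatMap; allFin; [_])
open import Data.List.Membership.Propositional using (_∈_)
open import Data.List.Membership.Propositional.Properties using (∈-map⁺; ∈-concatMap⁺; ∈-allFin)
open import Data.List.Relation.Unary.Any using (Any)
open import Data.List.Relation.Unary.Any.Properties using (lookup-index)
open import Data.List.Relation.Binary.Suffix.Heterogeneous using (Suffix)
open import Data.List.Relation.Binary.Suffix.Heterogeneous.Properties using (suffix?)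
open import Data.Vec using (Vec; []; _∷_; _∷ʳ_)
import Data.Vec.Properties as VecP
import Data.Product.Properties as ProdP
open import Data.Product using (Σ; Σ-syntax; ∃; ∃-syntax; _×_; _,_)
open import Relation.Nullary using (¬_; yes; no)
open import Relation.Nullary.Decidable using (⌊_⌋)
open import Relation.Binary.PropositionalEquality using (_≡_; refl; subst; sym; cong)
open import Relation.Binary.Definitions using (DecidableEquality)

record Alphabet : Set₁ where
  field
    Carrier  : Set
    _≟ₐ_     : DecidableEquality Carrier
    elems    : List Carrier
    complete : (a : Carrier) → a ∈ elems
open Alphabet public

Word : Alphabet → Set
Word A = List (Carrier A)

Lang : Alphabet → Set
Lang A = Word A → Bool

SameLang : (A : Alphabet) → Lang A → Lang A → Set
SameLang A L K = ∀ (w : Word A) → L w ≡ K w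

record DFA (A : Alphabet) : Set where
  field
    nStates : ℕ
    init    : Fin nStates
    δ       : Fin nStates → Carrier A → Fin nStates
    final   : Fin nStates → Bool

runDFA : {A : Alphabet} (M : DFA A) → Fin (DFA.nStates M) → Word A → Fin (DFA.nStates M)
runDFA M q []      = q
runDFA M q (a ∷ w) = runDFA M (DFA.δ M q a) w

accepts : {A : Alphabet} → DFA A → Lang A
accepts M w = DFA.final M (runDFA M (DFA.init M) w)

Regular : (A : Alphabet) → Lang A → Set
Regular A L = Σ[ M ∈ DFA A ] SameLang A L (accepts M)

Class : Set₁
Class = (A : Alphabet) → Lang A → Set

IsClassOfRegular : Class → Set₁
IsClassOfRegular 𝒟 = ∀ (A : Alphabet) (L : Lang A) → 𝒟 A L → Regular A L

IsLattice : Class → Set₁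
IsLattice 𝒟 =
    (∀ (A : Alphabet) → 𝒟 A (λ _ → false))
  × (∀ (A : Alphabet) → 𝒟 A (λ _ → true))
  × (∀ (A : Alphabet) (L K : Lang A) → 𝒟 A L → 𝒟 A K → 𝒟 A (λ w → L w ∨ K w))
  × (∀ (A : Alphabet) (L K : Lang A) → 𝒟 A L → 𝒟 A K → 𝒟 A (λ w → L w ∧ K w))

-- A monoid morphism α : A* → B* is determined by the images of letters;
-- it is length increasing when no letter is mapped to ε.
extend : (A B : Alphabet) → (Carrier A → Word B) → Word A → Word B
extend A B α w = concatMap α w

LengthIncreasing : (A B : Alphabet) → (Carrier A → Word B) → Set
LengthIncreasing A B α = ∀ (a : Carrier A) → ¬ (α a ≡ [])

ClosedInvLengthIncr : Class → Set₁
ClosedInvLengthIncr 𝒟 =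
  ∀ (A B : Alphabet) (α : Carrier A → Word B) → LengthIncreasing A B α →
  ∀ (L : Lang B) → 𝒟 B L → 𝒟 A (λ w → L (extend A B α w))

data BoolComb (X : Set) : Set where
  atom     : X → BoolComb X
  ⊤ᵇ ⊥ᵇ    : BoolComb X
  _∧ᵇ_ _∨ᵇ_ : BoolComb X → BoolComb X → BoolComb X
  ¬ᵇ_      : BoolComb X → BoolComb X

evalBC : {X W : Set} → (X → W → Bool) → BoolComb X → W → Bool
evalBC s (atom x)  w = s x w
evalBC s ⊤ᵇ        w = true
evalBC s ⊥ᵇ        w = false
evalBC s (e ∧ᵇ f)  w = evalBC s e w ∧ evalBC s f w
evalBC s (e ∨ᵇ f)  w = evalBC s e w ∨ evalBC s f w
evalBC s (¬ᵇ e)    w = not (evalBC s e w)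

suffixLang : (A : Alphabet) → Word A → Lang A
suffixLang A v u = ⌊ suffix? (_≟ₐ_ A) v u ⌋

SU : Class
SU A L = Σ[ e ∈ BoolComb (Word A) ] SameLang A L (evalBC (suffixLang A) e)

-- MOD(A): Boolean combinations of {w | |w| ≡ m mod d}, 0 ≤ m < d.
-- An atom (d' , m) encodes modulus d = d' + 1 and residue m < d.
modLang : (A : Alphabet) → Σ[ d' ∈ ℕ ] Fin (suc d') → Lang A
modLang A (d' , m) w = ⌊ length w % suc d' ≟ toℕ m ⌋

MOD : Class
MOD A L = Σ[ e ∈ BoolComb (Σ[ d' ∈ ℕ ] Fin (suc d')) ] SameLang A L (evalBC (modLang A) e)

_⊆ᶜ_ : Class → Class → Set₁
𝒞 ⊆ᶜ 𝒟 = ∀ (A : Alphabet) (L : Lang A) → 𝒞 A L → 𝒟 A L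

-- Block abstraction.
-- Letters of A_d: nonempty words of length ≤ d, i.e. a length k+1 with
-- k : Fin d, and a word of that length.

Block : Alphabet → ℕ → Set
Block A d = Σ[ k ∈ Fin d ] Vec (Carrier A) (suc (toℕ k))

module _ (A : Alphabet) where

  allVecs : (n : ℕ) → List (Vec (Carrier A) n)
  allVecs zero    = [ [] ]
  allVecs (suc n) = concatMap (λ a → map (a ∷_) (allVecs n)) (elems A)

  allVecs-complete : ∀ n (v : Vec (Carrier A) n) → v ∈ allVecs n
  allVecs-complete zero    []      = Any.here refl
  allVecs-complete (suc n) (a ∷ v) =
    ∈-concatMap⁺ (λ b → map (b ∷_) (allVecs n))
      (Data.List.Relation.Unary.Any.map (λ { refl → ∈-map⁺ (a ∷_) (allVecs-complete n v) }) (complete A a))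

  allBlocks : (d : ℕ) → List (Block A d)
  allBlocks d = concatMap (λ k → map (k ,_) (allVecs (suc (toℕ k)))) (allFin d)

  allBlocks-complete : ∀ d (b : Block A d) → b ∈ allBlocks d
  allBlocks-complete d (k , v) =
    ∈-concatMap⁺ (λ j → map (j ,_) (allVecs (suc (toℕ j))))
      (Data.List.Relation.Unary.Any.map (λ { refl → ∈-map⁺ (k ,_) (allVecs-complete _ v) }) (∈-allFin k))

BlockAlphabet : Alphabet → ℕ → Alphabet
BlockAlphabet A d = record
  { Carrier  = Block A d
  ; _≟ₐ_     = ProdP.≡-dec Data.Fin._≟_ (VecP.≡-dec (_≟ₐ_ A))
  ; elems    = allBlocks A d
  ; complete = allBlocks-complete A d
  }

mkBlock : (A : Alphabet) {d k : ℕ} → k < d → Vec (Carrier A) (suc k) → Block A d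
mkBlock A {k = k} k<d v =
  fromℕ< k<d , subst (λ m → Vec (Carrier A) (suc m)) (sym (toℕ-fromℕ< k<d)) v

-- μ_d for d = e + 1: cut from the left into factors of length d; the last
-- (shorter, nonempty) factor is kept, an empty last factor is dropped.
-- `buf` holds the current incomplete factor (of length k ≤ e).
μgo : (A : Alphabet) (e k : ℕ) → k ≤ e → Vec (Carrier A) k → Word A → List (Block A (suc e))
μgo A e zero    k≤e buf [] = []
μgo A e (suc k) k≤e buf [] = mkBlock A (m≤n⇒m≤1+n k≤e) buf ∷ []
μgo A e k k≤e buf (a ∷ w) with k ≟ e
... | yes refl = mkBlock A (s≤s k≤e) (buf ∷ʳ a) ∷ μgo A e zero z≤n [] w
... | no  k≢e  = μgo A e (suc k) (≤∧≢⇒< k≤e k≢e) (buf ∷ʳ a) w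

μ : (A : Alphabet) (e : ℕ) → Word A → Word (BlockAlphabet A (suc e))
μ A e w = μgo A e zero z≤n [] w

BlockClass : Class → Class
BlockClass 𝒟 A L =
  Σ[ e ∈ ℕ ] Σ[ K ∈ Lang (BlockAlphabet A (suc e)) ]
    (𝒟 (BlockAlphabet A (suc e)) K × (∀ (w : Word A) → L w ≡ K (μ A e w)))

-- A modular language is determined by |w| mod P, where P is a common
-- multiple of its moduli. Cutting w into blocks of length P, |w| mod P is
-- the length of the last block of μ_P(w) taken mod P (the empty word giving
-- no block at all). So the language is μ_P⁻¹(K) where K only inspects the
-- last letter of a word over A_P, and such a K is a Boolean combination of
-- languages A_P* b.
module Submission where

open import Defs
open import Data.Bool using (Bool; true; false; _∧_; _∨_; not; if_then_else_)
open import Data.Bool.Properties using (∨-identityʳ)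
open import Data.Nat using (ℕ; zero; suc; pred; _+_; _*_; _≤_; _<_; z≤n; s≤s; _≟_; NonZero)
open import Data.Nat.Properties using (≤∧≢⇒<; m≤n⇒m≤1+n; +-suc; +-comm; +-identityʳ; m*n≢0; suc-pred)
open import Data.Nat.DivMod using (_%_; n%n≡0; [m+n]%n≡m%n; m∣n⇒o%n%m≡o%m)
open import Data.Nat.Divisibility using (_∣_; ∣-trans; ∣-reflexive; m∣m*n; n∣m*n)
open import Data.Fin using (Fin; toℕ)
open import Data.Fin.Properties using (toℕ-fromℕ<)
open import Data.Maybe using (Maybe; just; nothing; maybe′)
open import Data.List using (List; []; _∷_; length; last; [_])
open import Data.List.Membership.Propositional using (_∈_)
open import Data.List.Relation.Unary.Any using (tail)
open import Data.List.Relation.Binary.Suffix.Heterogeneous using (Suffix; here; there)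
open import Data.List.Relation.Binary.Suffix.Heterogeneous.Properties using (suffix?)
open import Data.List.Relation.Binary.Pointwise.Base using ([]; _∷_)
open import Data.Vec using (Vec; []; _∷ʳ_)
open import Data.Product using (Σ-syntax; _,_)
open import Function using (_∘_)
open import Relation.Nullary using (Dec; yes; no)
open import Relation.Nullary.Decidable using (⌊_⌋)
open import Relation.Binary.PropositionalEquality using (_≡_; refl; sym; trans; cong; cong₂; module ≡-Reasoning)

evalBC-∘ : {X V W : Set} (s : X → V → Bool) (g : W → V) (e : BoolComb X) (w : W) →
           evalBC (λ x → s x ∘ g) e w ≡ evalBC s e (g w)
evalBC-∘ s g (atom x) w = refl
evalBC-∘ s g ⊤ᵇ       w = refl
evalBC-∘ s g ⊥ᵇ       w = refl
evalBC-∘ s g (e ∧ᵇ f) w = cong₂ _∧_ (evalBC-∘ s g e w) (evalBC-∘ s g f w)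
evalBC-∘ s g (e ∨ᵇ f) w = cong₂ _∨_ (evalBC-∘ s g e w) (evalBC-∘ s g f w)
evalBC-∘ s g (¬ᵇ e)   w = cong not (evalBC-∘ s g e w)

constᵇ : {X : Set} → Bool → BoolComb X
constᵇ true  = ⊤ᵇ
constᵇ false = ⊥ᵇ

evalBC-constᵇ : {X W : Set} (s : X → W → Bool) (b : Bool) (w : W) → evalBC s (constᵇ b) w ≡ b
evalBC-constᵇ s true  w = refl
evalBC-constᵇ s false w = refl

ifᵇ_then_else_ : {X : Set} → BoolComb X → BoolComb X → BoolComb X → BoolComb X
ifᵇ c then x else y = (c ∧ᵇ x) ∨ᵇ ((¬ᵇ c) ∧ᵇ y)

evalBC-ifᵇ : {X W : Set} (s : X → W → Bool) (c x y : BoolComb X) (w : W) →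
             evalBC s (ifᵇ c then x else y) w ≡ (if evalBC s c w then evalBC s x w else evalBC s y w)
evalBC-ifᵇ s c x y w with evalBC s c w
... | true  = ∨-identityʳ (evalBC s x w)
... | false = refl

ResidueClass : Set
ResidueClass = Σ[ d' ∈ ℕ ] Fin (suc d')

hasResidue : ResidueClass → ℕ → Bool
hasResidue (d' , m) n = ⌊ n % suc d' ≟ toℕ m ⌋

evalBC-modLang : (A : Alphabet) (e : BoolComb ResidueClass) (w : Word A) →
                 evalBC (modLang A) e w ≡ evalBC hasResidue e (length w)
evalBC-modLang A = evalBC-∘ hasResidue length

period : BoolComb ResidueClass → ℕ
period (atom (d' , _)) = suc d'
period ⊤ᵇ              = 1
period ⊥ᵇ              = 1
period (e ∧ᵇ f)        = period e * period f
period (e ∨ᵇ f)        = period e * period f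
period (¬ᵇ e)          = period e

period-nonZero : (e : BoolComb ResidueClass) → NonZero (period e)
period-nonZero (atom _) = _
period-nonZero ⊤ᵇ       = _
period-nonZero ⊥ᵇ       = _
period-nonZero (e ∧ᵇ f) = m*n≢0 (period e) (period f) {{period-nonZero e}} {{period-nonZero f}}
period-nonZero (e ∨ᵇ f) = m*n≢0 (period e) (period f) {{period-nonZero e}} {{period-nonZero f}}
period-nonZero (¬ᵇ e)   = period-nonZero e

evalBC-hasResidue-% : (e : BoolComb ResidueClass) (D n : ℕ) → period e ∣ suc D →
                      evalBC hasResidue e (n % suc D) ≡ evalBC hasResidue e n
evalBC-hasResidue-% (atom (d' , m)) D n P∣D =
  cong (λ r → ⌊ r ≟ toℕ m ⌋) (m∣n⇒o%n%m≡o%m (suc d') (suc D) n P∣D)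
evalBC-hasResidue-% ⊤ᵇ D n _ = refl
evalBC-hasResidue-% ⊥ᵇ D n _ = refl
evalBC-hasResidue-% (e ∧ᵇ f) D n P∣D =
  cong₂ _∧_ (evalBC-hasResidue-% e D n (∣-trans (m∣m*n (period f)) P∣D))
            (evalBC-hasResidue-% f D n (∣-trans (n∣m*n (period e)) P∣D))
evalBC-hasResidue-% (e ∨ᵇ f) D n P∣D =
  cong₂ _∨_ (evalBC-hasResidue-% e D n (∣-trans (m∣m*n (period f)) P∣D))
            (evalBC-hasResidue-% f D n (∣-trans (n∣m*n (period e)) P∣D))
evalBC-hasResidue-% (¬ᵇ e) D n P∣D = cong not (evalBC-hasResidue-% e D n P∣D)

module _ {X : Set} where

  last-of-suffix : {b : X} {u : List X} → Suffix _≡_ [ b ] u → last u ≡ just b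
  last-of-suffix (here (refl ∷ []))         = refl
  last-of-suffix (there (here (refl ∷ []))) = refl
  last-of-suffix (there s@(there _))        = last-of-suffix s

  suffix-of-last : {b : X} (u : List X) → last u ≡ just b → Suffix _≡_ [ b ] u
  suffix-of-last (x ∷ [])     refl = here (refl ∷ [])
  suffix-of-last (x ∷ y ∷ ys) eq   = there (suffix-of-last (y ∷ ys) eq)

  maybe′-last-∷ : {Y : Set} (f : X → Y) (y : Y) (x : X) (xs : List X) →
                  maybe′ f y (last (x ∷ xs)) ≡ maybe′ f (f x) (last xs)
  maybe′-last-∷ f y x []       = refl
  maybe′-last-∷ f y x (z ∷ zs) = trans (maybe′-last-∷ f y z zs) (sym (maybe′-last-∷ f (f x) z zs))

module _ (B : Alphabet) (f : Maybe (Carrier B) → Bool) where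

  lastLetterTest : List (Carrier B) → BoolComb (Word B)
  lastLetterTest []       = constᵇ (f nothing)
  lastLetterTest (b ∷ bs) = ifᵇ atom [ b ] then constᵇ (f (just b)) else lastLetterTest bs

  lastLetterTest-correct : (bs : List (Carrier B)) (u : Word B) → (∀ {x} → last u ≡ just x → x ∈ bs) →
                           evalBC (suffixLang B) (lastLetterTest bs) u ≡ f (last u)
  lastLetterTest-correct [] u covered with last u
  ... | nothing = evalBC-constᵇ (suffixLang B) (f nothing) u
  ... | just x  with () ← covered refl
  lastLetterTest-correct (b ∷ bs) u covered =
    trans (evalBC-ifᵇ (suffixLang B) (atom [ b ]) (constᵇ (f (just b))) (lastLetterTest bs) u)
          (byCases (suffix? (_≟ₐ_ B) [ b ] u))
    where
    byCases : (d : Dec (Suffix _≡_ [ b ] u)) →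
              (if ⌊ d ⌋ then evalBC (suffixLang B) (constᵇ (f (just b))) u
                        else evalBC (suffixLang B) (lastLetterTest bs) u) ≡ f (last u)
    byCases (yes b-suffix) =
      trans (evalBC-constᵇ (suffixLang B) (f (just b)) u) (cong f (sym (last-of-suffix b-suffix)))
    byCases (no ¬b-suffix) = lastLetterTest-correct bs u
      (λ eq → tail (λ { refl → ¬b-suffix (suffix-of-last u eq) }) (covered eq))

  last⁻¹∈SU : SU B (f ∘ last)
  last⁻¹∈SU = lastLetterTest (elems B) ,
    λ u → sym (lastLetterTest-correct (elems B) u (λ {x} _ → complete B x))

module _ (A : Alphabet) where

  blockSize : {d : ℕ} → Block A d → ℕ
  blockSize (k , _) = suc (toℕ k)

  lastBlockSize : {d : ℕ} → Maybe (Block A d) → ℕ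
  lastBlockSize = maybe′ blockSize 0

  blockSize-mkBlock : {d k : ℕ} (k<d : k < d) (v : Vec (Carrier A) (suc k)) → blockSize (mkBlock A k<d v) ≡ suc k
  blockSize-mkBlock k<d v = cong suc (toℕ-fromℕ< k<d)

  -- n is the size of the block emitted before the current one (0 if none); only its residue matters.
  μgo-lastBlockSize : (e k : ℕ) (k≤e : k ≤ e) (buf : Vec (Carrier A) k) (w : Word A) (n : ℕ) →
                      n % suc e ≡ 0 →
                      maybe′ blockSize n (last (μgo A e k k≤e buf w)) % suc e ≡ (k + length w) % suc e

  μgo-lastBlockSize-full : (k : ℕ) (k≤k : k ≤ k) (buf : Vec (Carrier A) k) (a : Carrier A) (w : Word A) (n : ℕ) →
                           let full = mkBlock A (s≤s k≤k) (buf ∷ʳ a) in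
                           maybe′ blockSize n (last (full ∷ μgo A k 0 z≤n [] w)) % suc k ≡ (k + suc (length w)) % suc k
  μgo-lastBlockSize-full k k≤k buf a w n = begin
    maybe′ blockSize n (last (full ∷ rest)) % suc k   ≡⟨ cong (_% suc k) (maybe′-last-∷ blockSize n full rest) ⟩
    maybe′ blockSize (blockSize full) (last rest) % suc k
      ≡⟨ μgo-lastBlockSize k 0 z≤n [] w (blockSize full) full%d≡0 ⟩
    length w % suc k                                  ≡⟨ [m+n]%n≡m%n (length w) (suc k) ⟨
    (length w + suc k) % suc k                        ≡⟨ cong (_% suc k) (+-comm (length w) (suc k)) ⟩
    (suc k + length w) % suc k                        ≡⟨ cong (_% suc k) (+-suc k (length w)) ⟨
    (k + suc (length w)) % suc k                      ∎
    where
    open ≡-Reasoning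
    full = mkBlock A (s≤s k≤k) (buf ∷ʳ a)
    rest = μgo A k 0 z≤n [] w
    full%d≡0 : blockSize full % suc k ≡ 0
    full%d≡0 = trans (cong (_% suc k) (blockSize-mkBlock (s≤s k≤k) (buf ∷ʳ a))) (n%n≡0 (suc k))

  μgo-lastBlockSize-partial : (e k : ℕ) (k<e : k < e) (buf : Vec (Carrier A) k) (a : Carrier A) (w : Word A) (n : ℕ) →
                              n % suc e ≡ 0 →
                              maybe′ blockSize n (last (μgo A e (suc k) k<e (buf ∷ʳ a) w)) % suc e ≡ (k + suc (length w)) % suc e
  μgo-lastBlockSize-partial e k k<e buf a w n n≡0 =
    trans (μgo-lastBlockSize e (suc k) k<e (buf ∷ʳ a) w n n≡0) (cong (_% suc e) (sym (+-suc k (length w))))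

  μgo-lastBlockSize e zero    k≤e buf [] n n≡0 = n≡0
  μgo-lastBlockSize e (suc k) k≤e buf [] n _   =
    cong (_% suc e) (trans (blockSize-mkBlock (m≤n⇒m≤1+n k≤e) buf) (cong suc (sym (+-identityʳ k))))
  μgo-lastBlockSize e zero k≤e buf (a ∷ w) n n≡0 with zero ≟ e
  ... | yes refl = μgo-lastBlockSize-full zero k≤e buf a w n
  ... | no k≢e   = μgo-lastBlockSize-partial e zero (≤∧≢⇒< k≤e k≢e) buf a w n n≡0
  μgo-lastBlockSize e (suc k) k≤e buf (a ∷ w) n n≡0 with suc k ≟ e
  ... | yes refl = μgo-lastBlockSize-full (suc k) k≤e buf a w n
  ... | no k≢e   = μgo-lastBlockSize-partial e (suc k) (≤∧≢⇒< k≤e k≢e) buf a w n n≡0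

  μ-lastBlockSize : (e : ℕ) (w : Word A) → lastBlockSize (last (μ A e w)) % suc e ≡ length w % suc e
  μ-lastBlockSize e w = μgo-lastBlockSize e 0 z≤n [] w 0 refl

lemma6p8 : (𝒟 : Class) → IsClassOfRegular 𝒟 → IsLattice 𝒟 → ClosedInvLengthIncr 𝒟 →
    SU ⊆ᶜ 𝒟 → MOD ⊆ᶜ BlockClass 𝒟
lemma6p8 𝒟 _ _ _ SU⊆𝒟 A L (e , L≡e) = d , K , SU⊆𝒟 Aₚ K (last⁻¹∈SU Aₚ f) , L≡K∘μ
  where
  open ≡-Reasoning
  d : ℕ
  d = pred (period e)
  Aₚ : Alphabet
  Aₚ = BlockAlphabet A (suc d)
  P∣d+1 : period e ∣ suc d
  P∣d+1 = ∣-reflexive (sym (suc-pred (period e) {{period-nonZero e}}))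
  f : Maybe (Block A (suc d)) → Bool
  f = evalBC hasResidue e ∘ lastBlockSize A
  K : Lang Aₚ
  K = f ∘ last
  L≡K∘μ : ∀ w → L w ≡ K (μ A d w)
  L≡K∘μ w = begin
    L w                                          ≡⟨ L≡e w ⟩
    evalBC (modLang A) e w                       ≡⟨ evalBC-modLang A e w ⟩
    evalBC hasResidue e (length w)               ≡⟨ evalBC-hasResidue-% e d (length w) P∣d+1 ⟨
    evalBC hasResidue e (length w % suc d)       ≡⟨ cong (evalBC hasResidue e) (μ-lastBlockSize A d w) ⟨
    evalBC hasResidue e (lastBlockSize A (last (μ A d w)) % suc d)
                                                 ≡⟨ evalBC-hasResidue-% e d _ P∣d+1 ⟩
    K (μ A d w)                                  ∎
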